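{- Let $G$ be a finite graph. Then $\Gamma(H)=h(H)$ for every induced subgraph $H$ of $G$ if and only if $\omega(H)=\gamma(H)$ for every induced subgraph $H$ of $G$.
   Context: All graphs are finite and simple. A $k$-coloring of $G$ is a surjective map $\varsigma\colon V(G)\to\{1,\dots,k\}$; it is proper if adjacent vertices get different colors. A $k$-coloring is pseudo-Grundy if every vertex of color $i$ is adjacent to some vertex of color $j$ for every $j<i$; a Grundy coloring is a proper pseudo-Grundy coloring. The pseudo-Grundy number $\gamma(G)$ is the largest $k$ for which $G$ has a pseudo-Grundy $k$-coloring, and the Grundy number $\Gamma(G)$ is the largest $k$ for which $G$ has a Grundy $k$-coloring. The Hadwiger number $h(G)$ is the largest $k$ such that $K_k$ is a minor of $G$ (obtained by deleting vertices, deleting edges and contracting edges). $\omega(G)$ is the clique number. -}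

module Defs where

open import Data.Nat using (ℕ; _≤_; _<_)
open import Data.Fin using (Fin; toℕ)
open import Data.Bool using (Bool; true; false)
open import Data.Maybe using (Maybe; just)
open import Data.Product using (Σ; ∃; _×_; _,_)
open import Relation.Binary.PropositionalEquality using (_≡_; _≢_)

record Graph : Set where
  field
    n      : ℕ
    adj    : Fin n → Fin n → Bool
    sym    : ∀ u v → adj u v ≡ adj v u
    irrefl : ∀ v → adj v v ≡ false

open Graph public

Adj : (G : Graph) → Fin (n G) → Fin (n G) → Set
Adj G u v = adj G u v ≡ true

-- The subgraph induced by (the image of) a map f : Fin m → Fin (n G).
-- Induced subgraphs of G are exactly (up to isomorphism) the graphs
-- induced G f with f injective.
induced : (G : Graph) {m : ℕ} → (Fin m → Fin (n G)) → Graph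
induced G {m} f = record
  { n      = m
  ; adj    = λ i j → adj G (f i) (f j)
  ; sym    = λ i j → sym G (f i) (f j)
  ; irrefl = λ i → irrefl G (f i)
  }

-- Colorings. A k-coloring is a surjective map V(G) → {1,…,k}; colour
-- i ∈ {1,…,k} is represented by the element i-1 of Fin k (order preserved).

Surjective : {a b : ℕ} → (Fin a → Fin b) → Set
Surjective {a} {b} c = ∀ (j : Fin b) → ∃ λ (v : Fin a) → c v ≡ j

Proper : (G : Graph) {k : ℕ} → (Fin (n G) → Fin k) → Set
Proper G c = ∀ u v → Adj G u v → c u ≢ c v

PseudoGrundyProp : (G : Graph) {k : ℕ} → (Fin (n G) → Fin k) → Set
PseudoGrundyProp G {k} c =
  ∀ (v : Fin (n G)) (j : Fin k) → toℕ j < toℕ (c v) →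
    ∃ λ (u : Fin (n G)) → Adj G v u × c u ≡ j

HasPseudoGrundy : Graph → ℕ → Set
HasPseudoGrundy G k =
  Σ (Fin (n G) → Fin k) λ c → Surjective c × PseudoGrundyProp G c

HasGrundy : Graph → ℕ → Set
HasGrundy G k =
  Σ (Fin (n G) → Fin k) λ c → Surjective c × Proper G c × PseudoGrundyProp G c

HasClique : Graph → ℕ → Set
HasClique G k =
  Σ (Fin k → Fin (n G)) λ f → ∀ (i j : Fin k) → i ≢ j → Adj G (f i) (f j)

-- A branch-set assignment is β : V(G) → Maybe (Fin k) (vertex v lies in
-- branch set i iff β v ≡ just i; disjointness is automatic).

data PathIn (G : Graph) (P : Fin (n G) → Set) : Fin (n G) → Fin (n G) → Set where
  here : ∀ {u} → P u → PathIn G P u u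
  step : ∀ {u w v} → P u → Adj G u w → PathIn G P w v → PathIn G P u v

HasCompleteMinor : Graph → ℕ → Set
HasCompleteMinor G k =
  Σ (Fin (n G) → Maybe (Fin k)) λ β →
      (∀ (i : Fin k) → ∃ λ v → β v ≡ just i)
    × (∀ (i : Fin k) (u v : Fin (n G)) → β u ≡ just i → β v ≡ just i →
         PathIn G (λ w → β w ≡ just i) u v)
    × (∀ (i j : Fin k) → i ≢ j →
         ∃ λ u → ∃ λ v → β u ≡ just i × β v ≡ just j × Adj G u v)

IsMax : (ℕ → Set) → ℕ → Set
IsMax P k = P k × (∀ j → P j → j ≤ k)

IsGrundyNumber IsPseudoGrundyNumber IsHadwigerNumber IsCliqueNumber : Graph → ℕ → Set
IsGrundyNumber G       = IsMax (HasGrundy G)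
IsPseudoGrundyNumber G = IsMax (HasPseudoGrundy G)
IsHadwigerNumber G     = IsMax (HasCompleteMinor G)
IsCliqueNumber G       = IsMax (HasClique G)

GrundyEqHadwiger : Graph → Set
GrundyEqHadwiger G = ∃ λ k → IsGrundyNumber G k × IsHadwigerNumber G k

CliqueEqPseudoGrundy : Graph → Set
CliqueEqPseudoGrundy G = ∃ λ k → IsCliqueNumber G k × IsPseudoGrundyNumber G k

module Submission where

-- Both
-- conditions turn out to be equivalent to G being {P₄,C₄}-free.
--
-- A path a–b–c–d without the chords ac and bd induces P₄ or C₄.
-- This 4-vertex graph is bipartite (ω = 2) but has a pseudo-Grundy
-- 3-colouring (γ ≥ 3).  P₄ has a Grundy 3-colouring but no K₃ minor, while
-- C₄ has a K₃ minor but no Grundy 3-colouring.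
--
-- In a {P₄,C₄}-free graph, climbing inside a vertex set S to a
-- vertex with an inclusion-maximal closed neighbourhood yields a vertex that
-- dominates its component of G[S] (the domination lemma).  By induction this
-- shows that K_k minors (Lemma A) and pseudo-Grundy k-colourings (Lemma B)
-- contain a K_k.  As cliques are minors, Grundy colourings are pseudo-Grundy,
-- and first fit gives a Grundy colouring with at least ω colours, all four
-- parameters then equal ω.  Being {P₄,C₄}-free passes to induced subgraphs,
-- which gives both implications.

open import Defs
open import Data.Nat using (ℕ)
open import Data.Fin using (Fin)
open import Data.Product using (_×_)
open import Relation.Binary.PropositionalEquality using (_≡_)
open import Function.Definitions using (Injective)

open import Data.Bool using (Bool; true; false)
import Data.Bool.Properties as Bool
open import Data.Empty using (⊥; ⊥-elim)
open import Data.Fin using (zero; suc; toℕ; fromℕ<; punchIn; punchOut)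
open import Data.Fin.Patterns using (0F; 1F; 2F; 3F)
open import Data.Fin.Properties
  using (_≟_; any?; all?; toℕ<n; toℕ-fromℕ<; toℕ-injective; ¬∀⟶∃¬; injective⇒≤;
         punchInᵢ≢i; punchIn-punchOut; punchOut-punchIn; punchOut-cong; punchIn-injective)
open import Data.Fin.Subset using (Subset; _∈_; _⊂_; _⊃_)
open import Data.Fin.Subset.Induction using (Acc; acc; ⊃-wellFounded)
open import Data.Maybe using (Maybe; just; nothing)
open import Data.Maybe.Properties using (just-injective)
open import Data.Nat using (zero; suc; pred; _≤_; _<_; _<?_; z≤n; s≤s)
import Data.Nat as ℕ
open import Data.Nat.Properties
  using (≤-refl; ≤-trans; <-trans; <-irrefl; ≤-pred; n<1+n; n≤1+n; m≤n⇒m≤1+n; ≮⇒≥; ≤-antisym;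
         ≤-<-trans; ≤∧≢⇒<; <⇒≤)
open import Data.Product using (Σ; ∃; _,_; proj₁; proj₂)
open import Data.Sum using (_⊎_; inj₁; inj₂)
open import Data.Unit using (⊤; tt)
open import Data.Vec using (tabulate)
open import Data.Vec.Properties using (lookup∘tabulate; []=⇒lookup; lookup⇒[]=)
open import Function using (_∘_)
open import Relation.Binary.PropositionalEquality using (_≢_; refl; trans; cong; subst) renaming (sym to ≡-sym)
open import Relation.Nullary using (¬_; Dec; yes; no; does)
open import Relation.Nullary.Decidable using (_×-dec_; _⊎-dec_; ¬?; dec-true; decidable-stable)
open import Relation.Unary using (Decidable)

Adj-sym : ∀ G {u v} → Adj G u v → Adj G v u
Adj-sym G {u} {v} uv = trans (sym G v u) uv

Adj-irrefl : ∀ G {u} → ¬ Adj G u u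
Adj-irrefl G {u} uu with trans (≡-sym (irrefl G u)) uu
... | ()

Adj⇒≢ : ∀ G {u v} → Adj G u v → u ≢ v
Adj⇒≢ G uv refl = Adj-irrefl G uv

Adj? : ∀ G u v → Dec (Adj G u v)
Adj? G u v = adj G u v Bool.≟ true

pathHead : ∀ {G P u v} → PathIn G P u v → P u
pathHead (here pu)     = pu
pathHead (step pu _ _) = pu

pathMap : ∀ {G P Q u v} → (∀ {w} → P w → Q w) → PathIn G P u v → PathIn G Q u v
pathMap h (here pu)         = here (h pu)
pathMap h (step pu uw rest) = step (h pu) uw (pathMap h rest)

toSubset : ∀ {m} {P : Fin m → Set} → Decidable P → Subset m
toSubset P? = tabulate (λ x → does (P? x))

∈-toSubset : ∀ {m} {P : Fin m → Set} (P? : Decidable P) {x} → P x → x ∈ toSubset P?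
∈-toSubset P? {x} px = lookup⇒[]= x _ (trans (lookup∘tabulate _ x) (dec-true (P? x) px))

toSubset-∈ : ∀ {m} {P : Fin m → Set} (P? : Decidable P) {x} → x ∈ toSubset P? → P x
toSubset-∈ P? {x} x∈ with P? x | trans (≡-sym (lookup∘tabulate (λ y → does (P? y)) x)) ([]=⇒lookup x∈)
... | yes px | _  = px
... | no _   | ()

-- G is {P₄, C₄}-free: no path a–b–c–d (a ≠ c, b ≠ d) has both chords ac
-- and bd missing.  Such a path induces P₄ if ad is a non-edge and C₄
-- otherwise, so this single condition excludes both induced subgraphs.
P4C4Free : Graph → Set
P4C4Free G = ∀ {a b c d} → a ≢ c → b ≢ d →
  Adj G a b → Adj G b c → Adj G c d → ¬ Adj G a c → ¬ Adj G b d → ⊥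

induced-P4C4Free : ∀ G {m} (f : Fin m → Fin (n G)) → Injective _≡_ _≡_ f →
  P4C4Free G → P4C4Free (induced G f)
induced-P4C4Free G f f-inj free a≢c b≢d = free (a≢c ∘ f-inj) (b≢d ∘ f-inj)

-- In a {P₄,C₄}-free graph, inside any vertex set S,
-- every vertex v lies in the closed neighbourhood of a vertex u whose
-- closed neighbourhood is closed under the edges of G[S]; that is, u is
-- adjacent to every other vertex of the component of v in G[S].
module Domination (G : Graph) (free : P4C4Free G)
                  (S : Fin (n G) → Set) (S? : Decidable S) where

  V : Set
  V = Fin (n G)

  N[_] : V → V → Set
  N[ u ] w = S w × (w ≡ u ⊎ Adj G u w)

  N[_]? : ∀ u → Decidable N[ u ]
  N[ u ]? w = S? w ×-dec ((w ≟ u) ⊎-dec Adj? G u w)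

  -- N[u] as a finite set, to measure progress while climbing
  ball : V → Subset (n G)
  ball u = toSubset N[ u ]?

  Dominating : V → Set
  Dominating u = ∀ {x y} → N[ u ] x → S y → Adj G x y → N[ u ] y

  -- If an S-edge xy leaves N[u] at a vertex x ∈ N[u], then N[u] ⊆ N[x]:
  -- a neighbour w ≠ x of u that is not adjacent to x would give the path
  -- w–u–x–y with both chords wx and uy missing.
  neighbourhood-grows : ∀ {u x y} → N[ u ] x → S y → Adj G x y → ¬ N[ u ] y →
    ∀ {w} → N[ u ] w → N[ x ] w
  neighbourhood-grows (_ , inj₁ refl) Sy xy y∉ _             = ⊥-elim (y∉ (Sy , inj₂ xy))
  neighbourhood-grows (_ , inj₂ ux)   _  _  _  (Sw , inj₁ refl) = Sw , inj₂ (Adj-sym G ux)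
  neighbourhood-grows {u} {x} {y} (_ , inj₂ ux) Sy xy y∉ {w} (Sw , inj₂ uw)
    with w ≟ x | Adj? G x w
  ... | yes w≡x | _     = Sw , inj₁ w≡x
  ... | no _    | yes xw = Sw , inj₂ xw
  ... | no w≢x  | no ¬xw =
    ⊥-elim (free w≢x u≢y (Adj-sym G uw) ux xy (¬xw ∘ Adj-sym G) (λ uy → y∉ (Sy , inj₂ uy)))
    where
    u≢y : u ≢ y
    u≢y u≡y = y∉ (Sy , inj₁ (≡-sym u≡y))

  neighbour : ∀ {u w} → N[ u ] w → w ≢ u → Adj G u w
  neighbour (_ , inj₁ w≡u) w≢u = ⊥-elim (w≢u w≡u)
  neighbour (_ , inj₂ uw)  _   = uw

  record Dominator (v : V) : Set where
    field
      centre     : V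
      centre∈S   : S centre
      dominating : Dominating centre
      covers     : N[ centre ] v

  -- Climb from u to a neighbour with a strictly larger closed neighbourhood
  -- until N[u] is closed; this terminates because ⊂ is well founded.
  climb : ∀ {v} u → Acc _⊃_ (ball u) → S u → N[ u ] v → Dominator v
  climb u (acc larger) Su v∈
    with any? (λ x → any? (λ y → N[ u ]? x ×-dec (S? y ×-dec (Adj? G x y ×-dec ¬? (N[ u ]? y)))))
  ... | yes (x , y , x∈ , Sy , xy , y∉) =
    climb x (larger ball⊂) (proj₁ x∈) (grows v∈)
    where
    grows : ∀ {w} → N[ u ] w → N[ x ] w
    grows = neighbourhood-grows x∈ Sy xy y∉
    ball⊂ : ball u ⊂ ball x
    ball⊂ = (λ w∈ → ∈-toSubset N[ x ]? (grows (toSubset-∈ N[ u ]? w∈)))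
          , y , ∈-toSubset N[ x ]? (Sy , inj₂ xy) , y∉ ∘ toSubset-∈ N[ u ]?
  ... | no noExit = record
    { centre = u ; centre∈S = Su ; covers = v∈
    ; dominating = λ {x} {y} x∈ Sy xy →
        decidable-stable (N[ u ]? y) (λ y∉ → noExit (x , y , x∈ , Sy , xy , y∉))
    }

  dominator : ∀ {v} → S v → Dominator v
  dominator {v} Sv = climb v (⊃-wellFounded (ball v)) Sv (Sv , inj₁ refl)

  dominated-path : ∀ {u a b} → Dominating u → N[ u ] a → PathIn G S a b → N[ u ] b
  dominated-path dom a∈ (here _)         = a∈
  dominated-path dom a∈ (step _ aw rest) = dominated-path dom (dom a∈ (pathHead rest) aw) rest

CliqueIn : (G : Graph) → (Fin (n G) → Set) → ℕ → Set
CliqueIn G T k = Σ (Fin k → Fin (n G)) λ f → (∀ t → T (f t)) × (∀ s t → s ≢ t → Adj G (f s) (f t))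

coneClique : ∀ G {T T′ : Fin (n G) → Set} {k} u → T u → (∀ {w} → T′ w → T w) →
  (∀ {w} → T′ w → Adj G u w) → CliqueIn G T′ k → CliqueIn G T (suc k)
coneClique G {T} {k = k} u Tu T′⊆T u-adj (f , fT′ , f-adj) = g , gT , g-adj
  where
  g : Fin (suc k) → Fin (n G)
  g zero    = u
  g (suc t) = f t
  gT : ∀ t → T (g t)
  gT zero    = Tu
  gT (suc t) = T′⊆T (fT′ t)
  g-adj : ∀ s t → s ≢ t → Adj G (g s) (g t)
  g-adj zero    zero    s≢t = ⊥-elim (s≢t refl)
  g-adj zero    (suc t) _   = u-adj (fT′ t)
  g-adj (suc s) zero    _   = Adj-sym G (u-adj (fT′ s))
  g-adj (suc s) (suc t) s≢t = f-adj s t (s≢t ∘ cong suc)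

MinorModel : (G : Graph) {k : ℕ} → (Fin (n G) → Maybe (Fin k)) → Set
MinorModel G {k} β =
    (∀ (i : Fin k) → ∃ λ v → β v ≡ just i)
  × (∀ (i : Fin k) (u v : Fin (n G)) → β u ≡ just i → β v ≡ just i →
       PathIn G (λ w → β w ≡ just i) u v)
  × (∀ (i j : Fin k) → i ≢ j →
       ∃ λ u → ∃ λ v → β u ≡ just i × β v ≡ just j × Adj G u v)

InBranch : ∀ {V : Set} {k} → (V → Maybe (Fin k)) → V → Set
InBranch β w = ∃ λ i → β w ≡ just i

InBranch? : ∀ {V : Set} {k} (β : V → Maybe (Fin k)) → Decidable (InBranch β)
InBranch? β w with β w
... | just i  = yes (i , refl)
... | nothing = no λ { (_ , ()) }

deleteLabel : ∀ {k} → Fin (suc k) → Maybe (Fin (suc k)) → Maybe (Fin k)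
deleteLabel i nothing = nothing
deleteLabel i (just l) with i ≟ l
... | yes _   = nothing
... | no i≢l  = just (punchOut i≢l)

deleteLabel-just : ∀ {k} (i : Fin (suc k)) m {l} → deleteLabel i m ≡ just l → m ≡ just (punchIn i l)
deleteLabel-just i (just l) e with i ≟ l
deleteLabel-just i (just l) () | yes _
deleteLabel-just i (just l) e  | no i≢l =
  cong just (trans (≡-sym (punchIn-punchOut i≢l)) (cong (punchIn i) (just-injective e)))

deleteLabel-punchIn : ∀ {k} (i : Fin (suc k)) m {l} → m ≡ just (punchIn i l) → deleteLabel i m ≡ just l
deleteLabel-punchIn i _ {l} refl with i ≟ punchIn i l
... | yes i≡ = ⊥-elim (punchInᵢ≢i i l (≡-sym i≡))
... | no i≢  = cong just (trans (punchOut-cong i refl) (punchOut-punchIn i))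

deleteBranch : ∀ G {k} {β : Fin (n G) → Maybe (Fin (suc k))} (i : Fin (suc k)) →
  MinorModel G β → MinorModel G (deleteLabel i ∘ β)
deleteBranch G {β = β} i (nonempty , connected , touching) =
    (λ l → let (v , e) = nonempty (punchIn i l) in v , deleteLabel-punchIn i (β v) e)
  , (λ l u v eu ev → pathMap (λ {w} e → deleteLabel-punchIn i (β w) e)
       (connected (punchIn i l) u v (deleteLabel-just i (β u) eu) (deleteLabel-just i (β v) ev)))
  , (λ l l' l≢l' →
       let (p , q , ep , eq , pq) = touching (punchIn i l) (punchIn i l') (l≢l' ∘ punchIn-injective i l l')
       in p , q , deleteLabel-punchIn i (β p) ep , deleteLabel-punchIn i (β q) eq , pq)

-- A dominating vertex u of the (connected) union of the branch
-- sets is adjacent to every vertex outside its own branch set; delete that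
-- branch set and recurse.
minorModelClique : ∀ G → P4C4Free G → ∀ k (β : Fin (n G) → Maybe (Fin k)) →
  MinorModel G β → CliqueIn G (InBranch β) k
minorModelClique G free zero β _ = (λ ()) , (λ ()) , (λ ())
minorModelClique G free (suc k) β model@(nonempty , connected , touching) =
  coneClique G u u∈S remaining⊆ remaining-adj
    (minorModelClique G free k (deleteLabel i ∘ β) (deleteBranch G i model))
  where
  open Domination G free (InBranch β) (InBranch? β)
  toS : ∀ {i w} → β w ≡ just i → InBranch β w
  toS {i} e = i , e
  v₀ : Fin (n G)
  v₀ = proj₁ (nonempty zero)
  v₀∈ : β v₀ ≡ just zero
  v₀∈ = proj₂ (nonempty zero)
  open Dominator (dominator (toS v₀∈)) renaming (centre to u; centre∈S to u∈S)
  -- the union of the branch sets is connected, so u dominates all of it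
  covered : ∀ {w} → InBranch β w → N[ u ] w
  covered {w} (b , w∈) with b ≟ zero
  ... | yes refl = dominated-path dominating covers (pathMap toS (connected zero v₀ w v₀∈ w∈))
  ... | no b≢0 =
    let (p , q , p∈ , q∈ , pq) = touching zero b (b≢0 ∘ ≡-sym)
        p-near = dominated-path dominating covers (pathMap toS (connected zero v₀ p v₀∈ p∈))
    in dominated-path dominating (dominating p-near (toS q∈) pq) (pathMap toS (connected b q w q∈ w∈))
  i : Fin (suc k)
  i = proj₁ u∈S
  remaining⊆ : ∀ {w} → InBranch (deleteLabel i ∘ β) w → InBranch β w
  remaining⊆ {w} (l , e) = punchIn i l , deleteLabel-just i (β w) e
  -- vertices of the other branch sets differ from u, so are its neighbours
  remaining-adj : ∀ {w} → InBranch (deleteLabel i ∘ β) w → Adj G u w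
  remaining-adj {w} (l , e) = neighbour (covered (remaining⊆ (l , e))) λ w≡u →
    punchInᵢ≢i i l (≡-sym (just-injective
      (trans (≡-sym (proj₂ u∈S)) (trans (cong β (≡-sym w≡u)) (deleteLabel-just i (β w) e)))))

-- Deleting colour a from the colours ℕ: skip a j is the j-th colour other
-- than a, and squeeze a renumbers the remaining colours consecutively.
skip : ℕ → ℕ → ℕ
skip a j with j <? a
... | yes _ = j
... | no _  = suc j

squeeze : ℕ → ℕ → ℕ
squeeze a x with x <? a
... | yes _ = x
... | no _  = pred x

skip≢ : ∀ a j → skip a j ≢ a
skip≢ a j e with j <? a
... | yes j<a = <-irrefl e j<a
... | no j≮a  = j≮a (subst (j <_) e (n<1+n j))

skip≤ : ∀ a j → skip a j ≤ suc j
skip≤ a j with j <? a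
... | yes _ = n≤1+n j
... | no _  = ≤-refl

squeeze-skip : ∀ a j → squeeze a (skip a j) ≡ j
squeeze-skip a j with j <? a
... | yes j<a with j <? a
...   | yes _    = refl
...   | no j≮a   = ⊥-elim (j≮a j<a)
squeeze-skip a j | no j≮a with suc j <? a
...   | yes sj<a = ⊥-elim (j≮a (<-trans (n<1+n j) sj<a))
...   | no _     = refl

skip-< : ∀ a j x → j < squeeze a x → skip a j < x
skip-< a j x j< with x <? a
skip-< a j x j< | yes x<a with j <? a
... | yes _   = j<
... | no j≮a  = ⊥-elim (j≮a (<-trans j< x<a))
skip-< a j (suc x) j< | no _ = ≤-<-trans (skip≤ a j) (s≤s j<)

record PartialPseudoGrundy (G : Graph) (T : Fin (n G) → Set) (k : ℕ) : Set where
  field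
    colour  : Fin (n G) → ℕ
    present : ∀ j → j < k → ∃ λ v → T v × colour v ≡ j
    grundy  : ∀ {v} → T v → ∀ j → j < colour v → ∃ λ w → T w × Adj G v w × colour w ≡ j

-- Let v have the top colour k and u
-- dominate v's component: N[u] contains all colours 0,…,k; deleting the
-- colour of u leaves a pseudo-Grundy k-colouring of the neighbourhood N(u).
pseudoGrundyClique : ∀ G → P4C4Free G → ∀ k (T : Fin (n G) → Set) (T? : Decidable T) →
  PartialPseudoGrundy G T k → CliqueIn G T k
pseudoGrundyClique G free zero T T? _ = (λ ()) , (λ ()) , (λ ())
pseudoGrundyClique G free (suc k) T T? PG = topClique (present k (n<1+n k))
  where
  open PartialPseudoGrundy PG
  open Domination G free T T?
  topClique : (∃ λ v → T v × colour v ≡ k) → CliqueIn G T (suc k)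
  topClique (v , Tv , v-top) =
    coneClique G u u∈T (proj₁ ∘ proj₁) (λ w∈ → neighbour (proj₁ w∈) (proj₂ w∈))
      (pseudoGrundyClique G free k T′ T′? PG′)
    where
    open Dominator (dominator Tv) renaming (centre to u; centre∈S to u∈T)
    a : ℕ
    a = colour u
    T′ : Fin (n G) → Set
    T′ w = N[ u ] w × w ≢ u
    T′? : Decidable T′
    T′? w = N[ u ]? w ×-dec ¬? (w ≟ u)
    nearby : ∀ j → j ≤ k → ∃ λ w → N[ u ] w × colour w ≡ j
    nearby j j≤k with j <? k
    ... | yes j<k = let (w , Tw , vw , cw) = grundy Tv j (subst (j <_) (≡-sym v-top) j<k)
                    in w , dominating covers Tw vw , cw
    ... | no j≮k = v , covers , trans v-top (≤-antisym (≮⇒≥ j≮k) j≤k)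
    off-centre : ∀ {w} → N[ u ] w → colour w ≢ a → T′ w
    off-centre w∈ c≢a = w∈ , λ w≡u → c≢a (cong colour w≡u)
    PG′ : PartialPseudoGrundy G T′ k
    PG′ = record
      { colour  = squeeze a ∘ colour
      ; present = λ j j<k →
          let (w , w∈ , cw) = nearby (skip a j) (≤-trans (skip≤ a j) j<k)
          in w , off-centre w∈ (λ e → skip≢ a j (trans (≡-sym cw) e))
               , trans (cong (squeeze a) cw) (squeeze-skip a j)
      ; grundy  = λ {w} w∈ j j< →
          let (w′ , Tw′ , ww′ , cw′) = grundy (proj₁ (proj₁ w∈)) (skip a j) (skip-< a j (colour w) j<)
          in w′ , off-centre (dominating (proj₁ w∈) Tw′ ww′) (λ e → skip≢ a j (trans (≡-sym cw′) e))
                , ww′ , trans (cong (squeeze a) cw′) (squeeze-skip a j)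
      }

minor⇒clique : ∀ G {k} → P4C4Free G → HasCompleteMinor G k → HasClique G k
minor⇒clique G {k} free (β , model) =
  let (f , _ , f-adj) = minorModelClique G free k β model in f , f-adj

pseudoGrundy⇒clique : ∀ G {k} → P4C4Free G → HasPseudoGrundy G k → HasClique G k
pseudoGrundy⇒clique G {k} free (c , c-onto , c-grundy) =
  let (f , _ , f-adj) = pseudoGrundyClique G free k (λ _ → ⊤) (λ _ → yes tt) PG in f , f-adj
  where
  PG : PartialPseudoGrundy G (λ _ → ⊤) k
  PG = record
    { colour  = toℕ ∘ c
    ; present = λ j j<k → let (v , cv) = c-onto (fromℕ< j<k)
                          in v , tt , trans (cong toℕ cv) (toℕ-fromℕ< j<k)
    ; grundy  = λ {v} _ j j< →
        let j<k = <-trans j< (toℕ<n (c v))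
            (w , vw , cw) = c-grundy v (fromℕ< j<k) (subst (_< toℕ (c v)) (≡-sym (toℕ-fromℕ< j<k)) j<)
        in w , tt , vw , trans (cong toℕ cw) (toℕ-fromℕ< j<k)
    }

-- In every graph a clique is a minor: use singleton branch sets.
clique⇒minor : ∀ G {k} → HasClique G k → HasCompleteMinor G k
clique⇒minor G {k} (h , h-adj) = β , nonempty , connected , touching
  where
  h-inj : ∀ {i i′} → h i ≡ h i′ → i ≡ i′
  h-inj {i} {i′} e with i ≟ i′
  ... | yes i≡i′ = i≡i′
  ... | no i≢i′  = ⊥-elim (Adj⇒≢ G (h-adj i i′ i≢i′) e)
  preimage : ∀ {w} → Dec (∃ λ i → h i ≡ w) → Maybe (Fin k)
  preimage (yes (i , _)) = just i
  preimage (no _)        = nothing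
  β : Fin (n G) → Maybe (Fin k)
  β w = preimage (any? (λ i → h i ≟ w))
  β-just : ∀ {w i} → β w ≡ just i → h i ≡ w
  β-just {w} e with any? (λ i → h i ≟ w)
  β-just refl | yes (_ , hi≡w) = hi≡w
  β-just ()   | no _
  β-h : ∀ i → β (h i) ≡ just i
  β-h i with any? (λ i′ → h i′ ≟ h i)
  ... | yes (i′ , e) = cong just (h-inj e)
  ... | no none      = ⊥-elim (none (i , refl))
  nonempty : ∀ i → ∃ λ v → β v ≡ just i
  nonempty i = h i , β-h i
  connected : ∀ i u v → β u ≡ just i → β v ≡ just i → PathIn G (λ w → β w ≡ just i) u v
  connected i u v eu ev =
    subst (PathIn G (λ w → β w ≡ just i) u) (trans (≡-sym (β-just eu)) (β-just ev)) (here eu)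
  touching : ∀ i i′ → i ≢ i′ → ∃ λ u → ∃ λ v → β u ≡ just i × β v ≡ just i′ × Adj G u v
  touching i i′ i≢i′ = h i , h i′ , β-h i , β-h i′ , h-adj i i′ i≢i′

grundy⇒pseudoGrundy : ∀ G {k} → HasGrundy G k → HasPseudoGrundy G k
grundy⇒pseudoGrundy G (c , c-onto , _ , c-grundy) = c , c-onto , c-grundy

-- A Grundy colouring is proper, hence injective on a clique.
clique≤grundy : ∀ G {j K} → HasClique G j → HasGrundy G K → j ≤ K
clique≤grundy G (h , h-adj) (c , _ , c-proper , _) = injective⇒≤ c∘h-inj
  where
  c∘h-inj : ∀ {s t} → c (h s) ≡ c (h t) → s ≡ t
  c∘h-inj {s} {t} e with s ≟ t
  ... | yes s≡t = s≡t
  ... | no s≢t  = ⊥-elim (c-proper (h s) (h t) (h-adj s t s≢t) e)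

least : ∀ {P : ℕ → Set} → Decidable P → ∀ {K} → P K → ∃ λ j → P j × (∀ i → i < j → ¬ P i)
least P? {zero} p0 = 0 , p0 , λ _ ()
least P? {suc K} pK with P? 0
... | yes p0 = 0 , p0 , λ _ ()
... | no ¬p0 =
  let (j , pj , below) = least (P? ∘ suc) pK
  in suc j , pj , λ { zero _ → ¬p0 ; (suc i) (s≤s i<j) → below i i<j }

-- Taking K = 1 + the largest colour turns such a
-- colouring into a Grundy K-colouring (surjectivity comes from the Grundy
-- property applied to a vertex of the largest colour).
module _ (G : Graph) where
  ℕProper : (Fin (n G) → ℕ) → Set
  ℕProper c = ∀ {u v} → Adj G u v → c u ≢ c v

  ℕGrundy : (Fin (n G) → ℕ) → Set
  ℕGrundy c = ∀ v j → j < c v → ∃ λ w → Adj G v w × c w ≡ j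

  ℕGrundy⇒HasGrundy : ∀ (c : Fin (n G) → ℕ) {B} → (∀ v → c v < B) → ℕProper c → ℕGrundy c →
    ∃ λ K → HasGrundy G K
  ℕGrundy⇒HasGrundy c {B} c<B c-proper c-grundy = K , c′ , c′-onto , c′-proper , c′-grundy
    where
    Bounds : ℕ → Set
    Bounds K = ∀ v → c v < K
    Bounds? : Decidable Bounds
    Bounds? K = all? (λ v → c v <? K)
    K : ℕ
    K = proj₁ (least Bounds? c<B)
    c<K : Bounds K
    c<K = proj₁ (proj₂ (least Bounds? c<B))
    -- K is least, so some vertex has colour K - 1
    top : ∀ {K′} → K ≡ suc K′ → ∃ λ v → c v ≡ K′
    top {K′} K≡ =
      let (v , ¬c<K′) = ¬∀⟶∃¬ _ (λ v → c v < K′) (λ v → c v <? K′)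
                          (proj₂ (proj₂ (least Bounds? c<B)) K′ (subst (K′ <_) (≡-sym K≡) (n<1+n K′)))
      in v , ≤-antisym (≤-pred (subst (c v <_) K≡ (c<K v))) (≮⇒≥ ¬c<K′)
    c′ : Fin (n G) → Fin K
    c′ v = fromℕ< (c<K v)
    toℕ-c′ : ∀ v → toℕ (c′ v) ≡ c v
    toℕ-c′ v = toℕ-fromℕ< (c<K v)
    has-colour : ∀ j → j < K → ∃ λ v → c v ≡ j
    has-colour j j<K with K in K≡
    has-colour j (s≤s j≤K′) | suc K′ with top K≡ | j <? K′
    ... | v , cv | yes j<K′ = let (w , _ , cw) = c-grundy v j (subst (j <_) (≡-sym cv) j<K′) in w , cw
    ... | v , cv | no j≮K′  = v , trans cv (≤-antisym (≮⇒≥ j≮K′) j≤K′)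
    c′-onto : Surjective c′
    c′-onto j = let (v , cv) = has-colour (toℕ j) (toℕ<n j)
                in v , toℕ-injective (trans (toℕ-c′ v) cv)
    c′-proper : Proper G c′
    c′-proper u v uv e = c-proper uv (trans (≡-sym (toℕ-c′ u)) (trans (cong toℕ e) (toℕ-c′ v)))
    c′-grundy : PseudoGrundyProp G c′
    c′-grundy v j j< =
      let (w , vw , cw) = c-grundy v (toℕ j) (subst (toℕ j <_) (toℕ-c′ v) j<)
      in w , vw , toℕ-injective (trans (toℕ-c′ w) cw)

-- Every graph has a Grundy colouring: colour the vertices in the order
-- 0, 1, …, n-1, giving each the least colour not used on its earlier
-- neighbours (first fit).
module FirstFit (G : Graph) where

  Early : ℕ → Fin (n G) → Set
  Early m v = toℕ v < m

  record Prefix (m : ℕ) : Set where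
    field
      colour  : Fin (n G) → ℕ
      bounded : ∀ {v} → Early m v → colour v < m
      proper  : ∀ {u v} → Early m u → Early m v → Adj G u v → colour u ≢ colour v
      grundy  : ∀ {v} → Early m v → ∀ j → j < colour v →
                  ∃ λ w → Early m w × Adj G v w × colour w ≡ j

  empty : Prefix 0
  empty = record { colour = λ _ → 0 ; bounded = λ () ; proper = λ () ; grundy = λ () }

  module Step {m} (m<n : m < n G) (P : Prefix m) where
    open Prefix P
    x : Fin (n G)
    x = fromℕ< m<n
    Used : ℕ → Set
    Used j = ∃ λ w → Early m w × Adj G x w × colour w ≡ j
    Used? : Decidable Used
    Used? j = any? (λ w → (toℕ w <? m) ×-dec (Adj? G x w ×-dec (colour w ℕ.≟ j)))
    -- colours used so far are below m, so some colour ≤ m is free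
    m-unused : ¬ Used m
    m-unused (w , early , _ , cw) = <-irrefl cw (bounded early)
    first-unused : ∃ λ μ → ¬ Used μ × (∀ i → i < μ → ¬ ¬ Used i)
    first-unused = least (¬? ∘ Used?) m-unused
    μ : ℕ
    μ = proj₁ first-unused
    μ-unused : ¬ Used μ
    μ-unused = proj₁ (proj₂ first-unused)
    below-used : ∀ i → i < μ → Used i
    below-used i i<μ = decidable-stable (Used? i) (proj₂ (proj₂ first-unused) i i<μ)
    μ≤m : μ ≤ m
    μ≤m = ≮⇒≥ (λ m<μ → m-unused (below-used m m<μ))
    colour′ : Fin (n G) → ℕ
    colour′ w with w ≟ x
    ... | yes _ = μ
    ... | no _  = colour w
    colour′-x : colour′ x ≡ μ
    colour′-x with x ≟ x
    ... | yes _  = refl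
    ... | no x≢x = ⊥-elim (x≢x refl)
    early≢x : ∀ {w} → Early m w → w ≢ x
    early≢x early refl = <-irrefl (toℕ-fromℕ< m<n) early
    colour′-early : ∀ {w} → Early m w → colour′ w ≡ colour w
    colour′-early {w} early with w ≟ x
    ... | yes w≡x = ⊥-elim (early≢x early w≡x)
    ... | no _    = refl
    split : ∀ {w} → Early (suc m) w → w ≡ x ⊎ Early m w
    split {w} early with w ≟ x
    ... | yes w≡x = inj₁ w≡x
    ... | no w≢x  = inj₂ (≤∧≢⇒< (≤-pred early) λ e →
                      w≢x (toℕ-injective (trans e (≡-sym (toℕ-fromℕ< m<n)))))
    still-early : ∀ {w} → Early m w → Early (suc m) w
    still-early = m≤n⇒m≤1+n
    bounded′ : ∀ {v} → Early (suc m) v → colour′ v < suc m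
    bounded′ early with split early
    ... | inj₁ refl = subst (_< suc m) (≡-sym colour′-x) (s≤s μ≤m)
    ... | inj₂ old  = subst (_< suc m) (≡-sym (colour′-early old)) (m≤n⇒m≤1+n (bounded old))
    clash : ∀ {w} → Early m w → Adj G x w → colour′ x ≢ colour′ w
    clash old xw e = μ-unused (_ , old , xw , trans (≡-sym (colour′-early old)) (trans (≡-sym e) colour′-x))
    proper′ : ∀ {u v} → Early (suc m) u → Early (suc m) v → Adj G u v → colour′ u ≢ colour′ v
    proper′ eu ev uv with split eu | split ev
    ... | inj₁ refl | inj₁ refl = ⊥-elim (Adj-irrefl G uv)
    ... | inj₁ refl | inj₂ old  = clash old uv
    ... | inj₂ old  | inj₁ refl = clash old (Adj-sym G uv) ∘ ≡-sym
    ... | inj₂ ou   | inj₂ ov   = λ e →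
      proper ou ov uv (trans (≡-sym (colour′-early ou)) (trans e (colour′-early ov)))
    grundy′ : ∀ {v} → Early (suc m) v → ∀ j → j < colour′ v →
      ∃ λ w → Early (suc m) w × Adj G v w × colour′ w ≡ j
    grundy′ ev j j< with split ev
    ... | inj₁ refl =
      let (w , old , xw , cw) = below-used j (subst (j <_) colour′-x j<)
      in w , still-early old , xw , trans (colour′-early old) cw
    ... | inj₂ old =
      let (w , old′ , vw , cw) = grundy old j (subst (j <_) (colour′-early old) j<)
      in w , still-early old′ , vw , trans (colour′-early old′) cw

    extended : Prefix (suc m)
    extended = record { colour = colour′ ; bounded = bounded′ ; proper = proper′ ; grundy = grundy′ }

  prefix : ∀ m → m ≤ n G → Prefix m
  prefix zero    _   = empty
  prefix (suc m) m<n = Step.extended m<n (prefix m (<⇒≤ m<n))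

  firstFit : ∃ λ K → HasGrundy G K
  firstFit = ℕGrundy⇒HasGrundy G colour (λ v → bounded (toℕ<n v))
    (λ {u} {v} → proper (toℕ<n u) (toℕ<n v))
    (λ v j j< → let (w , _ , vw , cw) = grundy (toℕ<n v) j j< in w , vw , cw)
    where open Prefix (prefix (n G) ≤-refl)

pigeonhole : ∀ {A : Set} {x y r s t : A} → r ≢ s → r ≢ t → s ≢ t →
  x ≡ r ⊎ y ≡ r → x ≡ s ⊎ y ≡ s → x ≡ t ⊎ y ≡ t → ⊥
pigeonhole r≢s r≢t s≢t (inj₁ xr) (inj₁ xs) _          = r≢s (trans (≡-sym xr) xs)
pigeonhole r≢s r≢t s≢t (inj₁ xr) (inj₂ ys) (inj₁ xt) = r≢t (trans (≡-sym xr) xt)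
pigeonhole r≢s r≢t s≢t (inj₁ xr) (inj₂ ys) (inj₂ yt) = s≢t (trans (≡-sym ys) yt)
pigeonhole r≢s r≢t s≢t (inj₂ yr) (inj₁ xs) (inj₁ xt) = s≢t (trans (≡-sym xs) xt)
pigeonhole r≢s r≢t s≢t (inj₂ yr) (inj₁ xs) (inj₂ yt) = r≢t (trans (≡-sym yr) yt)
pigeonhole r≢s r≢t s≢t (inj₂ yr) (inj₂ ys) _          = r≢s (trans (≡-sym yr) ys)

alternate : ∀ {x y z t : Bool} → x ≢ y → y ≢ z → z ≢ t → x ≢ t
alternate {false} {false} x≢y _ _ = ⊥-elim (x≢y refl)
alternate {true}  {true}  x≢y _ _ = ⊥-elim (x≢y refl)
alternate {false} {true}  {true}  _ y≢z _ = ⊥-elim (y≢z refl)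
alternate {true}  {false} {false} _ y≢z _ = ⊥-elim (y≢z refl)
alternate {false} {true}  {false} _ _ z≢t = z≢t
alternate {true}  {false} {true}  _ _ z≢t = z≢t

module Quadruple (G : Graph) {a b c d : Fin (n G)} (a≢c : a ≢ c) (b≢d : b ≢ d)
                 (ab : Adj G a b) (bc : Adj G b c) (cd : Adj G c d)
                 (¬ac : ¬ Adj G a c) (¬bd : ¬ Adj G b d) where

  quad : Fin 4 → Fin (n G)
  quad 0F = a
  quad 1F = b
  quad 2F = c
  quad 3F = d

  -- a = d would close the triangle a, b, c with chord ac
  a≢d : a ≢ d
  a≢d refl = ¬ac (Adj-sym G cd)

  quad-injective : Injective _≡_ _≡_ quad
  quad-injective {0F} {0F} _ = refl
  quad-injective {0F} {1F} e = ⊥-elim (Adj⇒≢ G ab e)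
  quad-injective {0F} {2F} e = ⊥-elim (a≢c e)
  quad-injective {0F} {3F} e = ⊥-elim (a≢d e)
  quad-injective {1F} {0F} e = ⊥-elim (Adj⇒≢ G ab (≡-sym e))
  quad-injective {1F} {1F} _ = refl
  quad-injective {1F} {2F} e = ⊥-elim (Adj⇒≢ G bc e)
  quad-injective {1F} {3F} e = ⊥-elim (b≢d e)
  quad-injective {2F} {0F} e = ⊥-elim (a≢c (≡-sym e))
  quad-injective {2F} {1F} e = ⊥-elim (Adj⇒≢ G bc (≡-sym e))
  quad-injective {2F} {2F} _ = refl
  quad-injective {2F} {3F} e = ⊥-elim (Adj⇒≢ G cd e)
  quad-injective {3F} {0F} e = ⊥-elim (a≢d (≡-sym e))
  quad-injective {3F} {1F} e = ⊥-elim (b≢d (≡-sym e))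
  quad-injective {3F} {2F} e = ⊥-elim (Adj⇒≢ G cd (≡-sym e))
  quad-injective {3F} {3F} _ = refl

  H : Graph
  H = induced G quad

  -- H is bipartite with sides {a, c} and {b, d}
  side : Fin 4 → Bool
  side 0F = true
  side 1F = false
  side 2F = true
  side 3F = false

  same-side-nonadjacent : ∀ i j → side i ≡ side j → ¬ Adj H i j
  same-side-nonadjacent 0F 0F _ = Adj-irrefl H
  same-side-nonadjacent 0F 2F _ = ¬ac
  same-side-nonadjacent 1F 1F _ = Adj-irrefl H
  same-side-nonadjacent 1F 3F _ = ¬bd
  same-side-nonadjacent 2F 0F _ = ¬ac ∘ Adj-sym G
  same-side-nonadjacent 2F 2F _ = Adj-irrefl H
  same-side-nonadjacent 3F 1F _ = ¬bd ∘ Adj-sym G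
  same-side-nonadjacent 3F 3F _ = Adj-irrefl H
  same-side-nonadjacent 0F 1F ()
  same-side-nonadjacent 0F 3F ()
  same-side-nonadjacent 1F 0F ()
  same-side-nonadjacent 1F 2F ()
  same-side-nonadjacent 2F 1F ()
  same-side-nonadjacent 2F 3F ()
  same-side-nonadjacent 3F 0F ()
  same-side-nonadjacent 3F 2F ()

  crosses : ∀ {i j} → Adj H i j → side i ≢ side j
  crosses {i} {j} ij same = same-side-nonadjacent i j same ij

  -- ω(H) ≤ 2: the sides cannot alternate around a triangle
  noTriangle : ∀ {k} → 3 ≤ k → ¬ HasClique H k
  noTriangle (s≤s (s≤s (s≤s _))) (f , f-adj) =
    alternate (crosses (f-adj 0F 1F λ ())) (crosses (f-adj 1F 2F λ ())) (crosses (f-adj 2F 0F λ ())) refl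

  colour3 : Fin 4 → Fin 3
  colour3 0F = 0F
  colour3 1F = 2F
  colour3 2F = 1F
  colour3 3F = 0F

  colour3-onto : Surjective colour3
  colour3-onto 0F = 0F , refl
  colour3-onto 1F = 2F , refl
  colour3-onto 2F = 1F , refl

  colour3-pseudoGrundy : PseudoGrundyProp H colour3
  colour3-pseudoGrundy 1F 0F _ = 0F , Adj-sym G ab , refl
  colour3-pseudoGrundy 1F 1F _ = 2F , bc , refl
  colour3-pseudoGrundy 2F 0F _ = 3F , cd , refl
  colour3-pseudoGrundy 0F _  ()
  colour3-pseudoGrundy 1F 2F (s≤s (s≤s ()))
  colour3-pseudoGrundy 2F 1F (s≤s ())
  colour3-pseudoGrundy 2F 2F (s≤s ())
  colour3-pseudoGrundy 3F _  ()

  pseudoGrundy3 : HasPseudoGrundy H 3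
  pseudoGrundy3 = colour3 , colour3-onto , colour3-pseudoGrundy

  -- The induced P₄ (ad a non-edge): Γ(H) ≥ 3 but H has no K₃ minor.
  module Path (¬ad : ¬ Adj G a d) where

    colour3-proper : Proper H colour3
    colour3-proper 0F 0F aa _ = Adj-irrefl H aa
    colour3-proper 0F 3F ad _ = ¬ad ad
    colour3-proper 3F 0F da _ = ¬ad (Adj-sym G da)
    colour3-proper 3F 3F dd _ = Adj-irrefl H dd
    colour3-proper 0F 1F _ ()
    colour3-proper 0F 2F _ ()
    colour3-proper 1F 0F _ ()
    colour3-proper 1F 1F bb _ = Adj-irrefl H bb
    colour3-proper 1F 2F _ ()
    colour3-proper 1F 3F _ ()
    colour3-proper 2F 0F _ ()
    colour3-proper 2F 1F _ ()
    colour3-proper 2F 2F cc _ = Adj-irrefl H cc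
    colour3-proper 2F 3F _ ()
    colour3-proper 3F 1F _ ()
    colour3-proper 3F 2F _ ()

    grundy3 : HasGrundy H 3
    grundy3 = colour3 , colour3-onto , colour3-proper , colour3-pseudoGrundy

    end₀ : ∀ {v} → Adj H 0F v → v ≡ 1F
    end₀ {0F} aa = ⊥-elim (Adj-irrefl H aa)
    end₀ {1F} _  = refl
    end₀ {2F} ac = ⊥-elim (¬ac ac)
    end₀ {3F} ad = ⊥-elim (¬ad ad)

    end₃ : ∀ {v} → Adj H 3F v → v ≡ 2F
    end₃ {0F} da = ⊥-elim (¬ad (Adj-sym G da))
    end₃ {1F} db = ⊥-elim (¬bd (Adj-sym G db))
    end₃ {2F} _  = refl
    end₃ {3F} dd = ⊥-elim (Adj-irrefl H dd)

    leave₀ : ∀ {P v} → PathIn H P 0F v → v ≢ 0F → P 1F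
    leave₀     (here _)         v≢0 = ⊥-elim (v≢0 refl)
    leave₀ {P} (step _ aw rest) _   = subst P (end₀ aw) (pathHead rest)

    leave₃ : ∀ {P v} → PathIn H P 3F v → v ≢ 3F → P 2F
    leave₃     (here _)         v≢3 = ⊥-elim (v≢3 refl)
    leave₃ {P} (step _ dw rest) _   = subst P (end₃ dw) (pathHead rest)

    -- In a K_k minor model of P₄, every branch set touching two others
    -- contains an inner vertex b or c: a branch set inside {a, d} is a
    -- single end vertex, which touches only one other branch set.
    module _ {k} {β : Fin 4 → Maybe (Fin k)} where
      touched₀ : ∀ {q j} → β q ≡ just j → Adj H 0F q → β 1F ≡ just j
      touched₀ {j = j} q∈ aq = subst (λ v → β v ≡ just j) (end₀ aq) q∈

      touched₃ : ∀ {q j} → β q ≡ just j → Adj H 3F q → β 2F ≡ just j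
      touched₃ {j = j} q∈ dq = subst (λ v → β v ≡ just j) (end₃ dq) q∈

      inner : MinorModel H β → ∀ i j l → i ≢ j → i ≢ l → j ≢ l → β 1F ≡ just i ⊎ β 2F ≡ just i
      inner (_ , connected , touching) i j l i≢j i≢l j≢l with touching i j i≢j | touching i l i≢l
      ... | 1F , _ , p∈ , _ , _ | _ = inj₁ p∈
      ... | 2F , _ , p∈ , _ , _ | _ = inj₂ p∈
      ... | _ | 1F , _ , p∈ , _ , _ = inj₁ p∈
      ... | _ | 2F , _ , p∈ , _ , _ = inj₂ p∈
      ... | 0F , _ , _ , q∈ , aq | 0F , _ , _ , q′∈ , aq′ =
        ⊥-elim (j≢l (just-injective (trans (≡-sym (touched₀ q∈ aq)) (touched₀ q′∈ aq′))))
      ... | 3F , _ , _ , q∈ , dq | 3F , _ , _ , q′∈ , dq′ =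
        ⊥-elim (j≢l (just-injective (trans (≡-sym (touched₃ q∈ dq)) (touched₃ q′∈ dq′))))
      ... | 0F , _ , p∈ , _ , _ | 3F , _ , p′∈ , _ , _ = inj₁ (leave₀ (connected i 0F 3F p∈ p′∈) λ ())
      ... | 3F , _ , p∈ , _ , _ | 0F , _ , p′∈ , _ , _ = inj₂ (leave₃ (connected i 3F 0F p∈ p′∈) λ ())

    -- h(H) ≤ 2: three branch sets would need three different inner vertices
    noK3Minor : ∀ {k} → 3 ≤ k → ¬ HasCompleteMinor H k
    noK3Minor (s≤s (s≤s (s≤s _))) (β , model) =
      pigeonhole {r = just 0F} {s = just 1F} {t = just 2F} (λ ()) (λ ()) (λ ())
        (inner model 0F 1F 2F (λ ()) (λ ()) (λ ()))
        (inner model 1F 0F 2F (λ ()) (λ ()) (λ ()))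
        (inner model 2F 0F 1F (λ ()) (λ ()) (λ ()))

  -- The induced C₄ (ad an edge): h(H) ≥ 3 but Γ(H) ≤ 2.
  module Cycle (ad : Adj G a d) where

    opposite-adjacent : ∀ i j → side i ≢ side j → Adj H i j
    opposite-adjacent 0F 1F _ = ab
    opposite-adjacent 0F 3F _ = ad
    opposite-adjacent 1F 0F _ = Adj-sym G ab
    opposite-adjacent 1F 2F _ = bc
    opposite-adjacent 2F 1F _ = Adj-sym G bc
    opposite-adjacent 2F 3F _ = cd
    opposite-adjacent 3F 0F _ = Adj-sym G ad
    opposite-adjacent 3F 2F _ = Adj-sym G cd
    opposite-adjacent 0F 0F ≢ = ⊥-elim (≢ refl)
    opposite-adjacent 0F 2F ≢ = ⊥-elim (≢ refl)
    opposite-adjacent 1F 1F ≢ = ⊥-elim (≢ refl)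
    opposite-adjacent 1F 3F ≢ = ⊥-elim (≢ refl)
    opposite-adjacent 2F 0F ≢ = ⊥-elim (≢ refl)
    opposite-adjacent 2F 2F ≢ = ⊥-elim (≢ refl)
    opposite-adjacent 3F 1F ≢ = ⊥-elim (≢ refl)
    opposite-adjacent 3F 3F ≢ = ⊥-elim (≢ refl)

    -- contract the edge cd: branch sets {a}, {b}, {c, d}
    branch : Fin 4 → Maybe (Fin 3)
    branch 0F = just 0F
    branch 1F = just 1F
    branch 2F = just 2F
    branch 3F = just 2F

    branch-connected : ∀ i u v → branch u ≡ just i → branch v ≡ just i →
      PathIn H (λ w → branch w ≡ just i) u v
    branch-connected _ 0F 0F refl refl = here refl
    branch-connected _ 1F 1F refl refl = here refl
    branch-connected _ 2F 2F refl refl = here refl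
    branch-connected _ 2F 3F refl refl = step refl cd (here refl)
    branch-connected _ 3F 2F refl refl = step refl (Adj-sym G cd) (here refl)
    branch-connected _ 3F 3F refl refl = here refl
    branch-connected _ 0F 1F refl ()
    branch-connected _ 0F 2F refl ()
    branch-connected _ 0F 3F refl ()
    branch-connected _ 1F 0F refl ()
    branch-connected _ 1F 2F refl ()
    branch-connected _ 1F 3F refl ()
    branch-connected _ 2F 0F refl ()
    branch-connected _ 2F 1F refl ()
    branch-connected _ 3F 0F refl ()
    branch-connected _ 3F 1F refl ()

    branch-touching : ∀ i j → i ≢ j →
      ∃ λ u → ∃ λ v → branch u ≡ just i × branch v ≡ just j × Adj H u v
    branch-touching 0F 1F _ = 0F , 1F , refl , refl , ab
    branch-touching 0F 2F _ = 0F , 3F , refl , refl , ad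
    branch-touching 1F 0F _ = 1F , 0F , refl , refl , Adj-sym G ab
    branch-touching 1F 2F _ = 1F , 2F , refl , refl , bc
    branch-touching 2F 0F _ = 3F , 0F , refl , refl , Adj-sym G ad
    branch-touching 2F 1F _ = 2F , 1F , refl , refl , Adj-sym G bc
    branch-touching 0F 0F ≢ = ⊥-elim (≢ refl)
    branch-touching 1F 1F ≢ = ⊥-elim (≢ refl)
    branch-touching 2F 2F ≢ = ⊥-elim (≢ refl)

    minor3 : HasCompleteMinor H 3
    minor3 = branch , (λ i → branch-nonempty i) , branch-connected , branch-touching
      where
      branch-nonempty : ∀ i → ∃ λ v → branch v ≡ just i
      branch-nonempty 0F = 0F , refl
      branch-nonempty 1F = 1F , refl
      branch-nonempty 2F = 2F , refl

    -- A vertex v of colour 2 has neighbours u₀, u₁ of colours 0, 1, and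
    -- u₁ has a neighbour w of colour 0.  The walk w, u₁, v, u₀ alternates
    -- sides, so w and u₀ lie on opposite sides, are adjacent, and share a colour.
    noGrundy3 : ∀ {k} → 3 ≤ k → ¬ HasGrundy H k
    noGrundy3 {suc (suc (suc k))} (s≤s (s≤s (s≤s _))) (c , c-onto , c-proper , c-grundy)
      with c-onto 2F
    ... | v , cv with c-grundy v 0F (subst (λ x → 0 < toℕ x) (≡-sym cv) (s≤s z≤n))
                    | c-grundy v 1F (subst (λ x → 1 < toℕ x) (≡-sym cv) (s≤s (s≤s z≤n)))
    ...   | u₀ , vu₀ , cu₀ | u₁ , vu₁ , cu₁
      with c-grundy u₁ 0F (subst (λ x → 0 < toℕ x) (≡-sym cu₁) (s≤s z≤n))
    ...     | w , u₁w , cw =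
      c-proper w u₀ (opposite-adjacent w u₀ opposite-sides) (trans cw (≡-sym cu₀))
      where
      opposite-sides : side w ≢ side u₀
      opposite-sides = alternate (crosses (Adj-sym H u₁w)) (crosses vu₁ ∘ ≡-sym) (crosses vu₀)

  grundy≠hadwiger : ¬ GrundyEqHadwiger H
  grundy≠hadwiger (_ , (grundy , grundy-max) , (minor , minor-max)) with Adj? G a d
  ... | no ¬ad = Path.noK3Minor ¬ad (grundy-max 3 (Path.grundy3 ¬ad)) minor
  ... | yes ad = Cycle.noGrundy3 ad (minor-max 3 (Cycle.minor3 ad)) grundy

  clique≠pseudoGrundy : ¬ CliqueEqPseudoGrundy H
  clique≠pseudoGrundy (_ , (clique , _) , (_ , pseudo-max)) = noTriangle (pseudo-max 3 pseudoGrundy3) clique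

-- Every Grundy colouring is
-- pseudo-Grundy, so Γ ≤ γ = ω, and the first-fit colouring gives Γ ≥ ω.
cliqueNumber⇒others : ∀ G {k} → P4C4Free G → IsCliqueNumber G k →
  IsPseudoGrundyNumber G k × IsGrundyNumber G k × IsHadwigerNumber G k
cliqueNumber⇒others G {k} free (clique , maximum) =
    (grundy⇒pseudoGrundy G grundyk , pseudo-bound)
  , (grundyk , λ j → pseudo-bound j ∘ grundy⇒pseudoGrundy G)
  , (clique⇒minor G clique , λ j → maximum j ∘ minor⇒clique G free)
  where
  pseudo-bound : ∀ j → HasPseudoGrundy G j → j ≤ k
  pseudo-bound j = maximum j ∘ pseudoGrundy⇒clique G free
  grundyk : HasGrundy G k
  grundyk with FirstFit.firstFit G
  ... | K , grundyK =
    subst (HasGrundy G) K≡k grundyK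
    where
    K≡k : K ≡ k
    K≡k = ≤-antisym (pseudo-bound K (grundy⇒pseudoGrundy G grundyK)) (clique≤grundy G clique grundyK)

hadwigerNumber⇒cliqueNumber : ∀ G {k} → P4C4Free G → IsHadwigerNumber G k → IsCliqueNumber G k
hadwigerNumber⇒cliqueNumber G free (minor , maximum) =
  minor⇒clique G free minor , λ j clique → maximum j (clique⇒minor G clique)

ForAllInduced : (Graph → Set) → Graph → Set
ForAllInduced P G = ∀ (m : ℕ) (f : Fin m → Fin (n G)) → Injective _≡_ _≡_ f → P (induced G f)

-- Either hypothesis of Corollary 7 forces G to be {P₄,C₄}-free, since an
-- induced P₄ or C₄ violates both equalities.
grundyEqHadwiger⇒P4C4Free : ∀ G → ForAllInduced GrundyEqHadwiger G → P4C4Free G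
grundyEqHadwiger⇒P4C4Free G hyp a≢c b≢d ab bc cd ¬ac ¬bd = grundy≠hadwiger (hyp 4 quad quad-injective)
  where open Quadruple G a≢c b≢d ab bc cd ¬ac ¬bd

cliqueEqPseudoGrundy⇒P4C4Free : ∀ G → ForAllInduced CliqueEqPseudoGrundy G → P4C4Free G
cliqueEqPseudoGrundy⇒P4C4Free G hyp a≢c b≢d ab bc cd ¬ac ¬bd = clique≠pseudoGrundy (hyp 4 quad quad-injective)
  where open Quadruple G a≢c b≢d ab bc cd ¬ac ¬bd

corollary7 : (G : Graph) →
    ((∀ (m : ℕ) (f : Fin m → Fin (n G)) → Injective _≡_ _≡_ f → GrundyEqHadwiger (induced G f)) →
      (∀ (m : ℕ) (f : Fin m → Fin (n G)) → Injective _≡_ _≡_ f → CliqueEqPseudoGrundy (induced G f)))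
    × ((∀ (m : ℕ) (f : Fin m → Fin (n G)) → Injective _≡_ _≡_ f → CliqueEqPseudoGrundy (induced G f)) →
      (∀ (m : ℕ) (f : Fin m → Fin (n G)) → Injective _≡_ _≡_ f → GrundyEqHadwiger (induced G f)))
corollary7 G = fromGrundyEqHadwiger , fromCliqueEqPseudoGrundy
  where
  fromGrundyEqHadwiger : ForAllInduced GrundyEqHadwiger G → ForAllInduced CliqueEqPseudoGrundy G
  fromGrundyEqHadwiger hyp m f f-inj with hyp m f f-inj
  ... | k , _ , hadwiger =
    let free = induced-P4C4Free G f f-inj (grundyEqHadwiger⇒P4C4Free G hyp)
        clique = hadwigerNumber⇒cliqueNumber (induced G f) free hadwiger
        (pseudo , _) = cliqueNumber⇒others (induced G f) free clique
    in k , clique , pseudo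
  fromCliqueEqPseudoGrundy : ForAllInduced CliqueEqPseudoGrundy G → ForAllInduced GrundyEqHadwiger G
  fromCliqueEqPseudoGrundy hyp m f f-inj with hyp m f f-inj
  ... | k , clique , _ =
    let free = induced-P4C4Free G f f-inj (cliqueEqPseudoGrundy⇒P4C4Free G hyp)
        (_ , grundy , hadwiger) = cliqueNumber⇒others (induced G f) free clique
    in k , grundy , hadwiger
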